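{- The systems $\mathsf{S_{RBL}}$ and $\mathsf{S^*_{RBL}}$ are equivalent: a sequent $A\Rightarrow B$ (with $A,B$ formulas of $\mathcal{L}_{\mathrm{RBL}}$) is derivable in $\mathsf{S_{RBL}}$ if and only if it is derivable in $\mathsf{S^*_{RBL}}$.
   Context: $\mathcal{L}_{\mathrm{RBL}}$-formulas are built from propositional letters $p$ and constants $\bot,\top$ by the binary connectives $\wedge,\vee,\cdot,\rightarrow,\leftarrow$. Sequents are expressions $A\Rightarrow B$ with $A,B$ formulas. The system $\mathsf{S_{RBL}}$ has the axioms: $A\Rightarrow A$; $\bot\Rightarrow A$; $A\Rightarrow\top$; $A\wedge(B\vee C)\Rightarrow (A\wedge B)\vee(A\wedge C)$; $(\mathrm{W}_l)$ $A\cdot\top\Rightarrow A$; $(\mathrm{W}_r)$ $\top\cdot A\Rightarrow A$; $(\mathrm{RC})$ $A\cdot B\Rightarrow (A\cdot B)\cdot B$; and the rules: Cut (from $A\Rightarrow B$ and $B\Rightarrow C$ infer $A\Rightarrow C$); residuation rules: from $A\cdot B\Rightarrow C$ infer $B\Rightarrow A\rightarrow C$ and conversely; from $A\cdot B\Rightarrow C$ infer $A\Rightarrow C\leftarrow B$ and conversely; from $A_i\Rightarrow B$ infer $A_1\wedge A_2\Rightarrow B$ ($i=1,2$); from $C\Rightarrow A$ and $C\Rightarrow B$ infer $C\Rightarrow A\wedge B$; from $A\Rightarrow C$ and $B\Rightarrow C$ infer $A\vee B\Rightarrow C$; from $C\Rightarrow A_i$ infer $C\Rightarrow A_1\vee A_2$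 ($i=1,2$). The system $\mathsf{S^*_{RBL}}$ is obtained from $\mathsf{S_{RBL}}$ by replacing the three axioms $(\mathrm{W}_l)$, $(\mathrm{W}_r)$, $(\mathrm{RC})$ respectively by the axioms $\top\Rightarrow A\rightarrow A$; $A\Rightarrow\top\rightarrow A$; $(A\rightarrow B)\wedge(B\rightarrow C)\Rightarrow A\rightarrow C$. -}

module Defs where

open import Data.Nat using (ℕ)

infixr 5 _⇒ᶠ_
infixl 5 _⇐ᶠ_
infixl 7 _·_
infixl 6 _∧ᶠ_
infixl 6 _∨ᶠ_

data Fm : Set where
  var  : ℕ → Fm
  ⊥ᶠ   : Fm
  ⊤ᶠ   : Fm
  _∧ᶠ_ : Fm → Fm → Fm
  _∨ᶠ_ : Fm → Fm → Fm
  _·_  : Fm → Fm → Fm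
  _⇒ᶠ_ : Fm → Fm → Fm
  _⇐ᶠ_ : Fm → Fm → Fm

infix 3 S-RBL_⇒_ S*-RBL_⇒_

data S-RBL_⇒_ : Fm → Fm → Set where
  id    : ∀ {A} → S-RBL A ⇒ A
  bot   : ∀ {A} → S-RBL ⊥ᶠ ⇒ A
  top   : ∀ {A} → S-RBL A ⇒ ⊤ᶠ
  distr : ∀ {A B C} → S-RBL A ∧ᶠ (B ∨ᶠ C) ⇒ (A ∧ᶠ B) ∨ᶠ (A ∧ᶠ C)
  Wl    : ∀ {A} → S-RBL A · ⊤ᶠ ⇒ A
  Wr    : ∀ {A} → S-RBL ⊤ᶠ · A ⇒ A
  RC    : ∀ {A B} → S-RBL A · B ⇒ (A · B) · B
  cut   : ∀ {A B C} → S-RBL A ⇒ B → S-RBL B ⇒ C → S-RBL A ⇒ C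
  res→  : ∀ {A B C} → S-RBL A · B ⇒ C → S-RBL B ⇒ A ⇒ᶠ C
  res→⁻ : ∀ {A B C} → S-RBL B ⇒ A ⇒ᶠ C → S-RBL A · B ⇒ C
  res←  : ∀ {A B C} → S-RBL A · B ⇒ C → S-RBL A ⇒ C ⇐ᶠ B
  res←⁻ : ∀ {A B C} → S-RBL A ⇒ C ⇐ᶠ B → S-RBL A · B ⇒ C
  ∧L₁   : ∀ {A₁ A₂ B} → S-RBL A₁ ⇒ B → S-RBL A₁ ∧ᶠ A₂ ⇒ B
  ∧L₂   : ∀ {A₁ A₂ B} → S-RBL A₂ ⇒ B → S-RBL A₁ ∧ᶠ A₂ ⇒ B
  ∧R    : ∀ {A B C} → S-RBL C ⇒ A → S-RBL C ⇒ B → S-RBL C ⇒ A ∧ᶠ B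
  ∨L    : ∀ {A B C} → S-RBL A ⇒ C → S-RBL B ⇒ C → S-RBL A ∨ᶠ B ⇒ C
  ∨R₁   : ∀ {A₁ A₂ C} → S-RBL C ⇒ A₁ → S-RBL C ⇒ A₁ ∨ᶠ A₂
  ∨R₂   : ∀ {A₁ A₂ C} → S-RBL C ⇒ A₂ → S-RBL C ⇒ A₁ ∨ᶠ A₂

data S*-RBL_⇒_ : Fm → Fm → Set where
  id    : ∀ {A} → S*-RBL A ⇒ A
  bot   : ∀ {A} → S*-RBL ⊥ᶠ ⇒ A
  top   : ∀ {A} → S*-RBL A ⇒ ⊤ᶠ
  distr : ∀ {A B C} → S*-RBL A ∧ᶠ (B ∨ᶠ C) ⇒ (A ∧ᶠ B) ∨ᶠ (A ∧ᶠ C)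
  W*l   : ∀ {A} → S*-RBL ⊤ᶠ ⇒ A ⇒ᶠ A
  W*r   : ∀ {A} → S*-RBL A ⇒ ⊤ᶠ ⇒ᶠ A
  RC*   : ∀ {A B C} → S*-RBL (A ⇒ᶠ B) ∧ᶠ (B ⇒ᶠ C) ⇒ A ⇒ᶠ C
  cut   : ∀ {A B C} → S*-RBL A ⇒ B → S*-RBL B ⇒ C → S*-RBL A ⇒ C
  res→  : ∀ {A B C} → S*-RBL A · B ⇒ C → S*-RBL B ⇒ A ⇒ᶠ C
  res→⁻ : ∀ {A B C} → S*-RBL B ⇒ A ⇒ᶠ C → S*-RBL A · B ⇒ C
  res←  : ∀ {A B C} → S*-RBL A · B ⇒ C → S*-RBL A ⇒ C ⇐ᶠ B
  res←⁻ : ∀ {A B C} → S*-RBL A ⇒ C ⇐ᶠ B → S*-RBL A · B ⇒ C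
  ∧L₁   : ∀ {A₁ A₂ B} → S*-RBL A₁ ⇒ B → S*-RBL A₁ ∧ᶠ A₂ ⇒ B
  ∧L₂   : ∀ {A₁ A₂ B} → S*-RBL A₂ ⇒ B → S*-RBL A₁ ∧ᶠ A₂ ⇒ B
  ∧R    : ∀ {A B C} → S*-RBL C ⇒ A → S*-RBL C ⇒ B → S*-RBL C ⇒ A ∧ᶠ B
  ∨L    : ∀ {A B C} → S*-RBL A ⇒ C → S*-RBL B ⇒ C → S*-RBL A ∨ᶠ B ⇒ C
  ∨R₁   : ∀ {A₁ A₂ C} → S*-RBL C ⇒ A₁ → S*-RBL C ⇒ A₁ ∨ᶠ A₂
  ∨R₂   : ∀ {A₁ A₂ C} → S*-RBL C ⇒ A₂ → S*-RBL C ⇒ A₁ ∨ᶠ A₂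

-- The two systems differ only in three axioms, so derivations translate rule by
-- rule once each system derives the other's three.  (W_l) and (W_r) are the
-- residuated forms of ⊤ ⇒ A → A and A ⇒ ⊤ → A.  For (RC): B lies below both
-- A → A·B and A·B → (A·B)·B, whose meet composes by (RC*).  For (RC*): with
-- X = (A→B)∧(B→C), contraction A·X ⇒ (A·X)·X lets X be used twice, once to
-- reach B from A and once to reach C from B.
module Submission where

open import Defs
open import Data.Product using (_×_; _,_)

module S = S-RBL_⇒_
module S* = S*-RBL_⇒_

module _ {A : Fm} where

  S*-Wl : S*-RBL A · ⊤ᶠ ⇒ A
  S*-Wl = S*.res→⁻ S*.W*l

  S*-Wr : S*-RBL ⊤ᶠ · A ⇒ A
  S*-Wr = S*.res→⁻ S*.W*r

  S-W*l : S-RBL ⊤ᶠ ⇒ A ⇒ᶠ A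
  S-W*l = S.res→ S.Wl

  S-W*r : S-RBL A ⇒ ⊤ᶠ ⇒ᶠ A
  S-W*r = S.res→ S.Wr

S*-RC : ∀ {A B} → S*-RBL A · B ⇒ (A · B) · B
S*-RC {A} {B} = S*.res→⁻ (S*.cut B≤composable S*.RC*)
  where
  B≤composable : S*-RBL B ⇒ (A ⇒ᶠ A · B) ∧ᶠ (A · B ⇒ᶠ (A · B) · B)
  B≤composable = S*.∧R (S*.res→ S*.id) (S*.res→ S*.id)

S-RC* : ∀ {A B C} → S-RBL (A ⇒ᶠ B) ∧ᶠ (B ⇒ᶠ C) ⇒ A ⇒ᶠ C
S-RC* {A} {B} {C} = S.res→ (S.cut S.RC (S.res←⁻ (S.cut reach-B (S.res← from-B))))
  where
  reach-B : S-RBL A · ((A ⇒ᶠ B) ∧ᶠ (B ⇒ᶠ C)) ⇒ B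
  reach-B = S.res→⁻ (S.∧L₁ S.id)

  from-B : S-RBL B · ((A ⇒ᶠ B) ∧ᶠ (B ⇒ᶠ C)) ⇒ C
  from-B = S.res→⁻ (S.∧L₂ S.id)

S⇒S* : ∀ {A B} → S-RBL A ⇒ B → S*-RBL A ⇒ B
S⇒S* S.id = S*.id
S⇒S* S.bot = S*.bot
S⇒S* S.top = S*.top
S⇒S* S.distr = S*.distr
S⇒S* S.Wl = S*-Wl
S⇒S* S.Wr = S*-Wr
S⇒S* S.RC = S*-RC
S⇒S* (S.cut d e) = S*.cut (S⇒S* d) (S⇒S* e)
S⇒S* (S.res→ d) = S*.res→ (S⇒S* d)
S⇒S* (S.res→⁻ d) = S*.res→⁻ (S⇒S* d)
S⇒S* (S.res← d) = S*.res← (S⇒S* d)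
S⇒S* (S.res←⁻ d) = S*.res←⁻ (S⇒S* d)
S⇒S* (S.∧L₁ d) = S*.∧L₁ (S⇒S* d)
S⇒S* (S.∧L₂ d) = S*.∧L₂ (S⇒S* d)
S⇒S* (S.∧R d e) = S*.∧R (S⇒S* d) (S⇒S* e)
S⇒S* (S.∨L d e) = S*.∨L (S⇒S* d) (S⇒S* e)
S⇒S* (S.∨R₁ d) = S*.∨R₁ (S⇒S* d)
S⇒S* (S.∨R₂ d) = S*.∨R₂ (S⇒S* d)

S*⇒S : ∀ {A B} → S*-RBL A ⇒ B → S-RBL A ⇒ B
S*⇒S S*.id = S.id
S*⇒S S*.bot = S.bot
S*⇒S S*.top = S.top
S*⇒S S*.distr = S.distr
S*⇒S S*.W*l = S-W*l
S*⇒S S*.W*r = S-W*r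
S*⇒S S*.RC* = S-RC*
S*⇒S (S*.cut d e) = S.cut (S*⇒S d) (S*⇒S e)
S*⇒S (S*.res→ d) = S.res→ (S*⇒S d)
S*⇒S (S*.res→⁻ d) = S.res→⁻ (S*⇒S d)
S*⇒S (S*.res← d) = S.res← (S*⇒S d)
S*⇒S (S*.res←⁻ d) = S.res←⁻ (S*⇒S d)
S*⇒S (S*.∧L₁ d) = S.∧L₁ (S*⇒S d)
S*⇒S (S*.∧L₂ d) = S.∧L₂ (S*⇒S d)
S*⇒S (S*.∧R d e) = S.∧R (S*⇒S d) (S*⇒S e)
S*⇒S (S*.∨L d e) = S.∨L (S*⇒S d) (S*⇒S e)
S*⇒S (S*.∨R₁ d) = S.∨R₁ (S*⇒S d)
S*⇒S (S*.∨R₂ d) = S.∨R₂ (S*⇒S d)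

theorem3 : (A B : Fm) → ((S-RBL A ⇒ B) → (S*-RBL A ⇒ B)) × ((S*-RBL A ⇒ B) → (S-RBL A ⇒ B))
theorem3 A B = S⇒S* , S*⇒S
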